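{- Let $d$ be an IL proof tree with conclusion $[P]\,\mathsf{r}\,[Q]$ and let $P',Q'$ be assertions. If the U-Turn judgment $d\vdash\langle P'\rangle\,\mathsf{r}\,\langle Q'\rangle$ is derivable without using rule (consSIL), then the IL triple $[P']\,\mathsf{r}\,[Q']$ is valid, i.e. $Q'\subseteq[\![\mathsf{r}]\!]P'$.
   Context: Language: atomic commands $\mathsf{c} ::= \mathtt{skip}\mid x:=a\mid b?\mid x:=\mathtt{nondet()}$; regular commands $\mathsf{r}::=\mathsf{c}\mid\mathsf{r};\mathsf{r}\mid\mathsf{r}\boxplus\mathsf{r}\mid\mathsf{r}^*$. States are pairs of a flag in $\{ok,er\}$ and a store $\sigma:\mathrm{Var}\to\mathbb{Z}$. Forward semantics on ok-states: $[\![\mathtt{skip}]\!]\sigma=\{\sigma\}$, $[\![x:=a]\!]\sigma=\{\sigma[x\mapsto[\![a]\!]\sigma]\}$, $[\![b?]\!]\sigma=\{\sigma\}$ if $b$ holds in $\sigma$ else $\varnothing$, $[\![x:=\mathtt{nondet()}]\!]\sigma=\{\sigma[x\mapsto v]\mid v\in\mathbb{Z}\}$ (ok-tagged results); every command maps an er-state $\sigma$ to $\{\sigma\}$; $[\![\mathsf{r}_1;\mathsf{r}_2]\!]\sigma=[\![\mathsf{r}_2]\!]([\![\mathsf{r}_1]\!]\sigma)$, $[\![\mathsf{r}_1\boxplus\mathsf{r}_2]\!]\sigma=[\![\mathsf{r}_1]\!]\sigma\cup[\![\mathsf{r}_2]\!]\sigma$, $[\![\mathsf{r}^*]\!]\sigma=\bigcup_{n\ge0}[\![\mathsf{r}]\!]^n\sigma$;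 lifted to sets by union. Assertions are sets of states; $\land,\lor,\implies,\text{false}$ are intersection, union, inclusion, $\varnothing$. For a set of stores $P$: $ok{:}P$ (resp. $er{:}P$) is the set of ok- (resp. er-)tagged states with store in $P$; $P[a/x]=\{\sigma\mid\sigma[x\mapsto[\![a]\!]\sigma]\in P\}$; $\exists x.P=\{\sigma[x\mapsto v]\mid\sigma\in P,v\in\mathbb{Z}\}$; $\mathrm{sp}_{x:=a}(P)=\{\sigma[x\mapsto[\![a]\!]\sigma]\mid\sigma\in P\}$. IL proof trees are built from: (assign) $[ok{:}P]\,x:=a\,[ok{:}\mathrm{sp}_{x:=a}(P)]$; (assume) $[ok{:}P]\,b?\,[ok{:}P\land b]$; (nondet) $[ok{:}P]\,x:=\mathtt{nondet()}\,[ok{:}\exists x.P]$; (skip) $[ok{:}P]\,\mathtt{skip}\,[ok{:}P]$; (er-id) $[er{:}P]\,\mathsf{r}\,[er{:}P]$; (disj) from $[P_1]\mathsf{r}[Q_1]$, $[P_2]\mathsf{r}[Q_2]$ infer $[P_1\lor P_2]\mathsf{r}[Q_1\lor Q_2]$; (cons) from $[P']\mathsf{r}[Q']$ with $P'\implies P$, $Q\implies Q'$ infer $[P]\mathsf{r}[Q]$; (seq) from $[P]\mathsf{r}_1[R]$, $[R]\mathsf{r}_2[Q]$ infer $[P]\mathsf{r}_1;\mathsf{r}_2[Q]$; (choiceL/R) from $[P]\mathsf{r}_i[Q]$ infer $[P]\mathsf{r}_1\boxplus\mathsf{r}_2[Q]$; (iter0) $[P]\mathsf{r}^*[P]$; (unroll)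 from $[P]\mathsf{r}^*;\mathsf{r}[Q]$ infer $[P]\mathsf{r}^*[Q]$. U-Turn judgments $d\vdash\langle P'\rangle\mathsf{r}\langle Q'\rangle$ ($d$ an IL proof tree concluding some $[P]\mathsf{r}[Q]$) are derived by the rules: (assign) if $d$ is the axiom $[ok{:}P]x:=a[ok{:}\mathrm{sp}_{x:=a}(P)]$ and $Q'\implies\mathrm{sp}_{x:=a}(P)$, then $d\vdash\langle ok{:}P\land Q'[a/x]\rangle x:=a\langle ok{:}Q'\rangle$; (nondet) if $d$ is the axiom $[ok{:}P]x:=\mathtt{nondet()}[ok{:}\exists x.P]$ and $Q'\implies\exists x.P$, then $d\vdash\langle ok{:}P\land\exists x.Q'\rangle x:=\mathtt{nondet()}\langle ok{:}Q'\rangle$; (assume) if $d$ is the axiom $[ok{:}P]b?[ok{:}P\land b]$ and $Q'\implies P\land b$, then $d\vdash\langle ok{:}Q'\rangle b?\langle ok{:}Q'\rangle$; (skip) if $d$ is the skip axiom with pre/post $P$ and $Q'\implies P$, then $d\vdash\langle Q'\rangle\mathtt{skip}\langle Q'\rangle$; (er-id) if $d$ is $[er{:}P]\mathsf{r}[er{:}P]$ and $Q'\implies P$, then $d\vdash\langle er{:}Q'\rangle\mathsf{r}\langle er{:}Q'\rangle$; (empty) for any $d$, $d\vdash\langle\text{false}\rangle\mathsf{r}\langle\text{false}\rangle$; (disj) if $d$ ends with IL (disj) with subtrees $d_1,d_2$ and $d_i\vdash\langle P_i'\rangle\mathsf{r}\langle Q_i'\rangle$, then $d\vdash\langle P_1'\lor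 P_2'\rangle\mathsf{r}\langle Q_1'\lor Q_2'\rangle$; (seq) if $d$ ends with IL (seq) with subtrees $d_1,d_2$ and $d_1\vdash\langle P'\rangle\mathsf{r}_1\langle R'\rangle$, $d_2\vdash\langle R'\rangle\mathsf{r}_2\langle Q'\rangle$, then $d\vdash\langle P'\rangle\mathsf{r}_1;\mathsf{r}_2\langle Q'\rangle$; (choiceL/R) if $d$ ends with IL (choiceL)/(choiceR) with subtree $d'$ and $d'\vdash\langle P'\rangle\mathsf{r}_i\langle Q'\rangle$, then $d\vdash\langle P'\rangle\mathsf{r}_1\boxplus\mathsf{r}_2\langle Q'\rangle$; (iter0) if $d$ is $[P]\mathsf{r}^*[P]$ and $Q'\implies P$, then $d\vdash\langle Q'\rangle\mathsf{r}^*\langle Q'\rangle$; (unroll) if $d$ ends with IL (unroll) with subtree $d'$ and $d'\vdash\langle P'\rangle\mathsf{r}^*;\mathsf{r}\langle Q'\rangle$, then $d\vdash\langle P'\rangle\mathsf{r}^*\langle Q'\rangle$; (consIL) if $d$ ends with IL (cons) concluding $[P]\mathsf{r}[Q]$ from subtree $d'$, $d'\vdash\langle P''\rangle\mathsf{r}\langle Q''\rangle$ and $Q''\implies Q$, then $d\vdash\langle P''\rangle\mathsf{r}\langle Q''\rangle$; (consSIL) if $d$ concludes $[P]\mathsf{r}[Q]$, $d\vdash\langle P''\rangle\mathsf{r}\langle Q''\rangle$, $\text{false}\not\equiv P'\implies P''$ and $Q''\implies Q'\implies Q$, then $d\vdash\langle P'\rangle\mathsf{r}\langle Q'\rangle$.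 -}

module Defs where

open import Data.Nat using (ℕ)
open import Data.Integer as ℤ using (ℤ)
open import Data.Bool using (Bool; true; false; if_then_else_; not; _∧_; _∨_)
open import Data.Product using (Σ; ∃; _×_; _,_; proj₁; proj₂)
open import Data.Sum using (_⊎_; inj₁; inj₂)
open import Data.Empty using (⊥)
open import Relation.Nullary using (¬_; does)
open import Relation.Binary.PropositionalEquality
  using (_≡_; refl; sym; trans; cong; cong₂; subst)
import Data.Nat.Properties as ℕP

Var : Set
Var = ℕ

data AExp : Set where
  num  : ℤ → AExp
  var  : Var → AExp
  plus minus times : AExp → AExp → AExp

data BExp : Set where
  tt ff : BExp
  leq eq : AExp → AExp → BExp
  bnot : BExp → BExp
  band bor : BExp → BExp → BExp

data Atom : Set where
  skip   : Atom
  assign : Var → AExp → Atom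
  assume : BExp → Atom
  nondet : Var → Atom

infixr 5 _⨟_
infixr 4 _⊞_
infix 6 _*
data Cmd : Set where
  atom : Atom → Cmd
  _⨟_  : Cmd → Cmd → Cmd
  _⊞_  : Cmd → Cmd → Cmd
  _*   : Cmd → Cmd

-- Stores are functions Var → ℤ; since Agda lacks
-- function extensionality, stores are compared pointwise (_≗ₛ_), and all
-- sets of stores/states are required to be closed under this equality
-- (as sets of mathematical functions automatically are).

Store : Set
Store = Var → ℤ

_≗ₛ_ : Store → Store → Set
σ ≗ₛ τ = ∀ y → σ y ≡ τ y

upd : Store → Var → ℤ → Store
upd σ x v y = if does (y ℕP.≟ x) then v else σ y

⟦_⟧a : AExp → Store → ℤ
⟦ num n ⟧a σ = n
⟦ var x ⟧a σ = σ x
⟦ plus a b ⟧a σ = ⟦ a ⟧a σ ℤ.+ ⟦ b ⟧a σ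
⟦ minus a b ⟧a σ = ⟦ a ⟧a σ ℤ.- ⟦ b ⟧a σ
⟦ times a b ⟧a σ = ⟦ a ⟧a σ ℤ.* ⟦ b ⟧a σ

⟦_⟧b : BExp → Store → Bool
⟦ tt ⟧b σ = true
⟦ ff ⟧b σ = false
⟦ leq a b ⟧b σ = does (⟦ a ⟧a σ ℤ.≤? ⟦ b ⟧a σ)
⟦ eq a b ⟧b σ = does (⟦ a ⟧a σ ℤ.≟ ⟦ b ⟧a σ)
⟦ bnot b ⟧b σ = not (⟦ b ⟧b σ)
⟦ band b c ⟧b σ = ⟦ b ⟧b σ ∧ ⟦ c ⟧b σ
⟦ bor b c ⟧b σ = ⟦ b ⟧b σ ∨ ⟦ c ⟧b σ

≗ₛ-sym : ∀ {σ τ} → σ ≗ₛ τ → τ ≗ₛ σ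
≗ₛ-sym e y = sym (e y)

≗ₛ-trans : ∀ {σ τ ρ} → σ ≗ₛ τ → τ ≗ₛ ρ → σ ≗ₛ ρ
≗ₛ-trans e f y = trans (e y) (f y)

a-resp : ∀ a {σ τ} → σ ≗ₛ τ → ⟦ a ⟧a σ ≡ ⟦ a ⟧a τ
a-resp (num n) e = refl
a-resp (var x) e = e x
a-resp (plus a b) e = cong₂ ℤ._+_ (a-resp a e) (a-resp b e)
a-resp (minus a b) e = cong₂ ℤ._-_ (a-resp a e) (a-resp b e)
a-resp (times a b) e = cong₂ ℤ._*_ (a-resp a e) (a-resp b e)

b-resp : ∀ b {σ τ} → σ ≗ₛ τ → ⟦ b ⟧b σ ≡ ⟦ b ⟧b τ
b-resp tt e = refl
b-resp ff e = refl
b-resp (leq a c) e rewrite a-resp a e | a-resp c e = refl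
b-resp (eq a c) e rewrite a-resp a e | a-resp c e = refl
b-resp (bnot b) e = cong not (b-resp b e)
b-resp (band b c) e = cong₂ _∧_ (b-resp b e) (b-resp c e)
b-resp (bor b c) e = cong₂ _∨_ (b-resp b e) (b-resp c e)

upd-cong : ∀ {σ τ} x {v w} → σ ≗ₛ τ → v ≡ w → upd σ x v ≗ₛ upd τ x w
upd-cong x e refl y with does (y ℕP.≟ x)
... | true = refl
... | false = e y

data State : Set where
  ok er : Store → State

_≈_ : State → State → Set
ok σ ≈ ok τ = σ ≗ₛ τ
er σ ≈ er τ = σ ≗ₛ τ
_ ≈ _ = ⊥

≈-trans : ∀ {s t u} → s ≈ t → t ≈ u → s ≈ u
≈-trans {ok _} {ok _} {ok _} e f = ≗ₛ-trans e f
≈-trans {er _} {er _} {er _} e f = ≗ₛ-trans e f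

record SAssn : Set₁ where
  field
    pred : Store → Set
    resp : ∀ {σ τ} → σ ≗ₛ τ → pred σ → pred τ
open SAssn public

record Assn : Set₁ where
  field
    holds : State → Set
    respA : ∀ {s t} → s ≈ t → holds s → holds t
open Assn public

_⇒_ : Assn → Assn → Set
P ⇒ Q = ∀ s → holds P s → holds Q s

_⇒ₛ_ : SAssn → SAssn → Set
P ⇒ₛ Q = ∀ σ → pred P σ → pred Q σ

falseA : Assn
falseA = record { holds = λ _ → ⊥ ; respA = λ _ () }

_∨A_ : Assn → Assn → Assn
P ∨A Q = record { holds = λ s → holds P s ⊎ holds Q s
                ; respA = λ { e (inj₁ p) → inj₁ (respA P e p)
                            ; e (inj₂ q) → inj₂ (respA Q e q) } }

_∧ₛ_ : SAssn → SAssn → SAssn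
P ∧ₛ Q = record { pred = λ σ → pred P σ × pred Q σ
                ; resp = λ e (p , q) → resp P e p , resp Q e q }

_∧b_ : SAssn → BExp → SAssn
P ∧b b = record { pred = λ σ → pred P σ × ⟦ b ⟧b σ ≡ true
                ; resp = λ e (p , h) → resp P e p , trans (sym (b-resp b e)) h }

okA : SAssn → Assn
okA P = record { holds = h ; respA = r }
  where
  h : State → Set
  h (ok σ) = pred P σ
  h (er σ) = ⊥
  r : ∀ {s t} → s ≈ t → h s → h t
  r {ok _} {ok _} e p = resp P e p

erA : SAssn → Assn
erA P = record { holds = h ; respA = r }
  where
  h : State → Set
  h (ok σ) = ⊥
  h (er σ) = pred P σ
  r : ∀ {s t} → s ≈ t → h s → h t
  r {er _} {er _} e p = resp P e p

_[_/_] : SAssn → AExp → Var → SAssn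
P [ a / x ] = record
  { pred = λ σ → pred P (upd σ x (⟦ a ⟧a σ))
  ; resp = λ e p → resp P (upd-cong x e (a-resp a e)) p }

∃[_]ₛ_ : Var → SAssn → SAssn
∃[ x ]ₛ P = record
  { pred = λ σ' → Σ Store λ σ → Σ ℤ λ v → pred P σ × σ' ≗ₛ upd σ x v
  ; resp = λ { e (σ , v , p , f) → σ , v , p , ≗ₛ-trans (≗ₛ-sym e) f } }

sp : Var → AExp → SAssn → SAssn
sp x a P = record
  { pred = λ σ' → Σ Store λ σ → pred P σ × σ' ≗ₛ upd σ x (⟦ a ⟧a σ)
  ; resp = λ { e (σ , p , f) → σ , p , ≗ₛ-trans (≗ₛ-sym e) f } }

-- Forward (collecting) semantics, as a relation  Sem r s t  ⇔  t ∈ ⟦r⟧s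
-- (results taken up to pointwise store equality)

data SemAtom : Atom → Store → Store → Set where
  s-skip   : ∀ {σ σ'} → σ' ≗ₛ σ → SemAtom skip σ σ'
  s-assign : ∀ {x a σ σ'} → σ' ≗ₛ upd σ x (⟦ a ⟧a σ) → SemAtom (assign x a) σ σ'
  s-assume : ∀ {b σ σ'} → ⟦ b ⟧b σ ≡ true → σ' ≗ₛ σ → SemAtom (assume b) σ σ'
  s-nondet : ∀ {x σ σ'} (v : ℤ) → σ' ≗ₛ upd σ x v → SemAtom (nondet x) σ σ'

mutual
  data Sem : Cmd → State → State → Set where
    sem-ok   : ∀ {c σ σ'} → SemAtom c σ σ' → Sem (atom c) (ok σ) (ok σ')
    sem-er   : ∀ {c σ σ'} → σ' ≗ₛ σ → Sem (atom c) (er σ) (er σ')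
    sem-seq  : ∀ {r₁ r₂ s t u} → Sem r₁ s t → Sem r₂ t u → Sem (r₁ ⨟ r₂) s u
    sem-chL  : ∀ {r₁ r₂ s t} → Sem r₁ s t → Sem (r₁ ⊞ r₂) s t
    sem-chR  : ∀ {r₁ r₂ s t} → Sem r₂ s t → Sem (r₁ ⊞ r₂) s t
    sem-star : ∀ {r s t} (n : ℕ) → Iter r n s t → Sem (r *) s t

  data Iter (r : Cmd) : ℕ → State → State → Set where
    it-zero : ∀ {s t} → t ≈ s → Iter r 0 s t
    it-suc  : ∀ {n s t u} → Iter r n s t → Sem r t u → Iter r (ℕ.suc n) s u

⟦_⟧ : Cmd → Assn → State → Set
⟦ r ⟧ P t = Σ State λ s → holds P s × Sem r s t

ILValid : Assn → Cmd → Assn → Set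
ILValid P r Q = ∀ t → holds Q t → ⟦ r ⟧ P t

data IL : Assn → Cmd → Assn → Set₁ where
  il-assign : ∀ (x : Var) (a : AExp) (P : SAssn) →
              IL (okA P) (atom (assign x a)) (okA (sp x a P))
  il-assume : ∀ (b : BExp) (P : SAssn) →
              IL (okA P) (atom (assume b)) (okA (P ∧b b))
  il-nondet : ∀ (x : Var) (P : SAssn) →
              IL (okA P) (atom (nondet x)) (okA (∃[ x ]ₛ P))
  il-skip   : ∀ (P : SAssn) → IL (okA P) (atom skip) (okA P)
  il-er-id  : ∀ (r : Cmd) (P : SAssn) → IL (erA P) r (erA P)
  il-disj   : ∀ {P₁ P₂ Q₁ Q₂ r} → IL P₁ r Q₁ → IL P₂ r Q₂ →
              IL (P₁ ∨A P₂) r (Q₁ ∨A Q₂)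
  il-cons   : ∀ {P P' Q Q' r} → IL P' r Q' → P' ⇒ P → Q ⇒ Q' → IL P r Q
  il-seq    : ∀ {P R Q r₁ r₂} → IL P r₁ R → IL R r₂ Q → IL P (r₁ ⨟ r₂) Q
  il-chL    : ∀ {P Q r₁ r₂} → IL P r₁ Q → IL P (r₁ ⊞ r₂) Q
  il-chR    : ∀ {P Q r₁ r₂} → IL P r₂ Q → IL P (r₁ ⊞ r₂) Q
  il-iter0  : ∀ (P : Assn) (r : Cmd) → IL P (r *) P
  il-unroll : ∀ {P Q r} → IL P ((r *) ⨟ r) Q → IL P (r *) Q

-- U-Turn judgments  d ⊢ ⟨P'⟩ r ⟨Q'⟩.
-- The parameter `sil` says whether rule (consSIL) may be used:
-- UTurn false d P' Q' is exactly derivability without (consSIL).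

data UTurn (sil : Bool) : ∀ {P r Q} → IL P r Q → Assn → Assn → Set₁ where
  ut-assign : ∀ {x a P} (Q' : SAssn) → Q' ⇒ₛ sp x a P →
              UTurn sil (il-assign x a P) (okA (P ∧ₛ (Q' [ a / x ]))) (okA Q')
  ut-nondet : ∀ {x P} (Q' : SAssn) → Q' ⇒ₛ (∃[ x ]ₛ P) →
              UTurn sil (il-nondet x P) (okA (P ∧ₛ (∃[ x ]ₛ Q'))) (okA Q')
  ut-assume : ∀ {b P} (Q' : SAssn) → Q' ⇒ₛ (P ∧b b) →
              UTurn sil (il-assume b P) (okA Q') (okA Q')
  ut-skip   : ∀ {P} (Q' : Assn) → Q' ⇒ okA P →
              UTurn sil (il-skip P) Q' Q'
  ut-er-id  : ∀ {r P} (Q' : SAssn) → Q' ⇒ₛ P →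
              UTurn sil (il-er-id r P) (erA Q') (erA Q')
  ut-empty  : ∀ {P r Q} (d : IL P r Q) → UTurn sil d falseA falseA
  ut-disj   : ∀ {P₁ P₂ Q₁ Q₂ r} {d₁ : IL P₁ r Q₁} {d₂ : IL P₂ r Q₂}
                {P₁' P₂' Q₁' Q₂'} →
              UTurn sil d₁ P₁' Q₁' → UTurn sil d₂ P₂' Q₂' →
              UTurn sil (il-disj d₁ d₂) (P₁' ∨A P₂') (Q₁' ∨A Q₂')
  ut-seq    : ∀ {P R Q r₁ r₂} {d₁ : IL P r₁ R} {d₂ : IL R r₂ Q} {P' R' Q'} →
              UTurn sil d₁ P' R' → UTurn sil d₂ R' Q' →
              UTurn sil (il-seq d₁ d₂) P' Q'
  ut-chL    : ∀ {P Q r₁ r₂} {d : IL P r₁ Q} {P' Q'} →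
              UTurn sil d P' Q' → UTurn sil (il-chL {r₂ = r₂} d) P' Q'
  ut-chR    : ∀ {P Q r₁ r₂} {d : IL P r₂ Q} {P' Q'} →
              UTurn sil d P' Q' → UTurn sil (il-chR {r₁ = r₁} d) P' Q'
  ut-iter0  : ∀ {P r} (Q' : Assn) → Q' ⇒ P → UTurn sil (il-iter0 P r) Q' Q'
  ut-unroll : ∀ {P Q r} {d : IL P ((r *) ⨟ r) Q} {P' Q'} →
              UTurn sil d P' Q' → UTurn sil (il-unroll d) P' Q'
  ut-consIL : ∀ {P P₀ Q Q₀ r} {d : IL P₀ r Q₀} {p : P₀ ⇒ P} {q : Q ⇒ Q₀}
                {P'' Q''} →
              UTurn sil d P'' Q'' → Q'' ⇒ Q →
              UTurn sil (il-cons {P = P} {Q = Q} d p q) P'' Q''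
  ut-consSIL : ∀ {P r Q} {d : IL P r Q} {P'' Q'' P' Q'} → sil ≡ true →
               UTurn sil d P'' Q'' →
               ¬ (P' ⇒ falseA) → P' ⇒ P'' → Q'' ⇒ Q' → Q' ⇒ Q →
               UTurn sil d P' Q'

{-# OPTIONS --safe #-}
module Submission where

open import Defs
open import Data.Bool using (false; true)
open import Data.Nat using (suc)
open import Data.Product using (_,_; proj₂)
open import Data.Sum using (inj₁; inj₂)
open import Relation.Nullary using (yes; no)
open import Relation.Nullary.Decidable using (dec-true; dec-false)
open import Relation.Binary.PropositionalEquality using (_≡_; _≢_; refl; sym; module ≡-Reasoning)
import Data.Nat.Properties as ℕP

-- Every U-Turn rule except (consSIL) preserves validity of the IL triple
-- [P'] r [Q'] on its own: for each final state in Q' the rule exhibits a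
-- predecessor in P'.  The tree d is consulted only through the side
-- conditions of the atomic rules, which supply that predecessor for
-- assignment and nondet and the truth of b for assume.

≈-refl : ∀ s → s ≈ s
≈-refl (ok σ) _ = refl
≈-refl (er σ) _ = refl

Sem-er-refl : ∀ r σ → Sem r (er σ) (er σ)
Sem-er-refl (atom c)  σ = sem-er (λ _ → refl)
Sem-er-refl (r₁ ⨟ r₂) σ = sem-seq (Sem-er-refl r₁ σ) (Sem-er-refl r₂ σ)
Sem-er-refl (r₁ ⊞ r₂) σ = sem-chL (Sem-er-refl r₁ σ)
Sem-er-refl (r *)     σ = sem-star 0 (it-zero (λ _ → refl))

upd-≡ : ∀ σ x v → upd σ x v x ≡ v
upd-≡ σ x v rewrite dec-true (x ℕP.≟ x) refl = refl

upd-≢ : ∀ σ {x y} v → y ≢ x → upd σ x v y ≡ σ y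
upd-≢ σ {x} {y} v y≢x rewrite dec-false (y ℕP.≟ x) y≢x = refl

upd-revert : ∀ {σ τ} x v → τ ≗ₛ upd σ x v → σ ≗ₛ upd τ x (σ x)
upd-revert {σ} {τ} x v e y with y ℕP.≟ x
... | yes refl = sym (upd-≡ τ x (σ x))
... | no y≢x   = begin
  σ y                ≡⟨ upd-≢ σ v y≢x ⟨
  upd σ x v y        ≡⟨ e y ⟨
  τ y                ≡⟨ upd-≢ τ (σ x) y≢x ⟨
  upd τ x (σ x) y    ∎
  where open ≡-Reasoning

ILValid-false : ∀ P r → ILValid P r falseA
ILValid-false P r t ()

ILValid-assign : ∀ {x a P} (Q : SAssn) → Q ⇒ₛ sp x a P →
                 ILValid (okA (P ∧ₛ (Q [ a / x ]))) (atom (assign x a)) (okA Q)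
ILValid-assign Q h (ok τ) q with h τ q
... | σ , p , e = ok σ , (p , resp Q e q) , sem-ok (s-assign e)

ILValid-nondet : ∀ {x P} (Q : SAssn) → Q ⇒ₛ (∃[ x ]ₛ P) →
                 ILValid (okA (P ∧ₛ (∃[ x ]ₛ Q))) (atom (nondet x)) (okA Q)
ILValid-nondet {x} Q h (ok τ) q with h τ q
... | σ , v , p , e =
  ok σ , (p , (τ , σ x , q , upd-revert x v e)) , sem-ok (s-nondet v e)

ILValid-assume : ∀ {b} (Q : SAssn) → (∀ σ → pred Q σ → ⟦ b ⟧b σ ≡ true) →
                 ILValid (okA Q) (atom (assume b)) (okA Q)
ILValid-assume Q h (ok τ) q = ok τ , q , sem-ok (s-assume (h τ q) (λ _ → refl))

ILValid-skip : ∀ Q → ILValid Q (atom skip) Q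
ILValid-skip Q (ok τ) q = ok τ , q , sem-ok (s-skip (λ _ → refl))
ILValid-skip Q (er τ) q = er τ , q , sem-er (λ _ → refl)

ILValid-er-id : ∀ Q r → ILValid (erA Q) r (erA Q)
ILValid-er-id Q r (er τ) q = er τ , q , Sem-er-refl r τ

ILValid-iter0 : ∀ Q r → ILValid Q (r *) Q
ILValid-iter0 Q r t q = t , q , sem-star 0 (it-zero (≈-refl t))

ILValid-disj : ∀ {P₁ P₂ Q₁ Q₂ r} → ILValid P₁ r Q₁ → ILValid P₂ r Q₂ →
               ILValid (P₁ ∨A P₂) r (Q₁ ∨A Q₂)
ILValid-disj v₁ v₂ t (inj₁ q) with v₁ t q
... | s , p , m = s , inj₁ p , m
ILValid-disj v₁ v₂ t (inj₂ q) with v₂ t q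
... | s , p , m = s , inj₂ p , m

ILValid-seq : ∀ {P R Q r₁ r₂} → ILValid P r₁ R → ILValid R r₂ Q →
              ILValid P (r₁ ⨟ r₂) Q
ILValid-seq v₁ v₂ t q with v₂ t q
... | s , r , m₂ with v₁ s r
...   | s₀ , p , m₁ = s₀ , p , sem-seq m₁ m₂

ILValid-chL : ∀ {P Q r₁ r₂} → ILValid P r₁ Q → ILValid P (r₁ ⊞ r₂) Q
ILValid-chL v t q with v t q
... | s , p , m = s , p , sem-chL m

ILValid-chR : ∀ {P Q r₁ r₂} → ILValid P r₂ Q → ILValid P (r₁ ⊞ r₂) Q
ILValid-chR v t q with v t q
... | s , p , m = s , p , sem-chR m

ILValid-unroll : ∀ {P Q r} → ILValid P ((r *) ⨟ r) Q → ILValid P (r *) Q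
ILValid-unroll v t q with v t q
... | s , p , sem-seq (sem-star n it) m = s , p , sem-star (suc n) (it-suc it m)

theorem4p7 : ∀ {P r Q} (d : IL P r Q) {P' Q' : Assn} →
             UTurn false d P' Q' → ILValid P' r Q'
theorem4p7 _ (ut-assign Q' h) = ILValid-assign Q' h
theorem4p7 _ (ut-nondet Q' h) = ILValid-nondet Q' h
theorem4p7 _ (ut-assume Q' h) = ILValid-assume Q' (λ σ q → proj₂ (h σ q))
theorem4p7 _ (ut-skip Q' _)   = ILValid-skip Q'
theorem4p7 (il-er-id r _) (ut-er-id Q' _) = ILValid-er-id Q' r
theorem4p7 {r = r} _      (ut-empty _)    = ILValid-false falseA r
theorem4p7 (il-iter0 _ r) (ut-iter0 Q' _) = ILValid-iter0 Q' r
-- ILValid sees its assertions only through `holds`, so their `respA` fields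
-- cannot be inferred and the structural rules get the assertions explicitly.
theorem4p7 (il-disj d₁ d₂) (ut-disj {P₁' = P₁'} {P₂'} {Q₁'} {Q₂'} u₁ u₂) =
  ILValid-disj {P₁'} {P₂'} {Q₁'} {Q₂'} (theorem4p7 d₁ u₁) (theorem4p7 d₂ u₂)
theorem4p7 (il-seq d₁ d₂) (ut-seq {P' = P'} {R'} {Q'} u₁ u₂) =
  ILValid-seq {P'} {R'} {Q'} (theorem4p7 d₁ u₁) (theorem4p7 d₂ u₂)
theorem4p7 (il-chL d) {P'} {Q'} (ut-chL u) = ILValid-chL {P'} {Q'} (theorem4p7 d u)
theorem4p7 (il-chR d) {P'} {Q'} (ut-chR u) = ILValid-chR {P'} {Q'} (theorem4p7 d u)
theorem4p7 (il-unroll d) {P'} {Q'} (ut-unroll u) = ILValid-unroll {P'} {Q'} (theorem4p7 d u)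
theorem4p7 (il-cons d _ _) (ut-consIL u _) = theorem4p7 d u
theorem4p7 _ (ut-consSIL () _ _ _ _ _)
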